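{- For every integer $k\ge 3$, $\mathcal M_{2,k}^{k+1}\not\to\mathcal M_{2,k}^{k}$.
   Context: $\mathbf{LO}_k^r$ is the $r$-ary structure with domain $[k]=\{1,\dots,k\}$ and relation consisting of all tuples in $[k]^r$ with a unique maximum. For $r$-ary structures $\mathbf{A},\mathbf{B}$, a $p$-ary polymorphism is a function $f: A^p\to B$ such that whenever an $r\times p$ matrix has every column in the relation of $\mathbf A$, applying $f$ to each row yields a tuple in the relation of $\mathbf B$. $\mathrm{Pol}(\mathbf A,\mathbf B)$ is the minion of all polymorphisms with minors $f_\pi(x_1,\dots,x_q)=f(x_{\pi(1)},\dots,x_{\pi(p)})$ for $\pi:[p]\to[q]$. $\mathcal{M}_{2,k}^r = \mathrm{Pol}(\mathbf{LO}_2^r,\mathbf{LO}_k^r)$. A minion homomorphism $\xi:\mathcal M\to\mathcal N$ maps $p$-ary elements to $p$-ary elements with $\xi(f)_\pi=\xi(f_\pi)$ for all $\pi,f$; $\mathcal M\not\to\mathcal N$ means no such homomorphism exists. -}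

module Defs where

open import Data.Nat using (ℕ; suc; _+_)
open import Data.Fin using (Fin; _<_)
open import Data.Product using (Σ; ∃; _,_; proj₁)
open import Relation.Binary.PropositionalEquality using (_≡_)
open import Relation.Nullary using (¬_)

UniqueMax : ∀ {r k} → (Fin r → Fin k) → Set
UniqueMax {r} x = ∃ λ (i : Fin r) → ∀ (j : Fin r) → ¬ (j ≡ i) → x j < x i

LO : (k r : ℕ) → (Fin r → Fin k) → Set
LO k r x = UniqueMax x

-- p-ary polymorphisms from LO_2^r to LO_k^r.  A matrix is M : Fin r → Fin p → Fin 2
-- (rows indexed by Fin r, columns by Fin p); column j is (λ i → M i j), row i is M i.
IsPol : (r k p : ℕ) → ((Fin p → Fin 2) → Fin k) → Set
IsPol r k p f =
  (M : Fin r → Fin p → Fin 2) →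
  (∀ (j : Fin p) → LO 2 r (λ i → M i j)) →
  LO k r (λ i → f (M i))

-- p-ary elements of the minion M^r_{2,k} = Pol(LO_2^r, LO_k^r).
Pol : (r k p : ℕ) → Set
Pol r k p = Σ ((Fin p → Fin 2) → Fin k) (IsPol r k p)

fun : ∀ {r k p} → Pol r k p → (Fin p → Fin 2) → Fin k
fun = proj₁

minorFun : ∀ {k p q} → (Fin p → Fin q) → ((Fin p → Fin 2) → Fin k) → (Fin q → Fin 2) → Fin k
minorFun π f x = f (λ i → x (π i))

record MinionHom (k r₁ r₂ : ℕ) : Set where
  field
    ξ : ∀ p → Pol r₁ k p → Pol r₂ k p
    commutes : ∀ {p q} (π : Fin p → Fin q) (f : Pol r₁ k p)
               (g : Pol r₁ k q) →
               (∀ x → fun g x ≡ minorFun π (fun f) x) →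
               ∀ x → fun (ξ q g) x ≡ minorFun π (fun (ξ p f)) x

{-# OPTIONS --safe #-}
-- For k ≥ 3 let f : {0,1}^k → [k] send the empty set to 1, singletons to 0 and a set with at least
-- two elements to its colour (see `colour`). It is a polymorphism LO₂^{k+1} → LO_k^{k+1}: the rows of
-- a matrix with columns in LO₂ are disjoint sets covering [k], so either some row has two elements,
-- and then disjoint such rows have distinct colours above 0 and 1, or exactly one row is empty.
-- Moreover f is constant on singletons and on co-singletons, so its binary minors f ∘ π_i, where π_i
-- collapses every coordinate except i, are all equal. Minion homomorphisms preserve this, but no
-- g ∈ Pol(LO₂^k, LO_k^k) has it: on the identity matrix every row of g is the same minor evaluated
-- at (1,0), so there is no unique maximum.
module Submission where

open import Defs
open import Data.Nat using (ℕ; _≤_; _+_)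
open import Relation.Nullary using (¬_)

open import Data.Nat using (zero; suc; pred; _⊔_; _<_; s≤s; s≤s⁻¹; z≤n; _≟_; _≤?_)
open import Data.Nat.Properties
open import Data.Fin using (Fin; zero; suc; toℕ; opposite; fromℕ<; punchIn; punchOut)
  renaming (_≟_ to _≟ᶠ_)
open import Data.Fin.Properties
  using (any?; toℕ-fromℕ<; toℕ-injective; toℕ<n; injective⇒≤; punchOut-injective; punchInᵢ≢i)
open import Data.Fin.Patterns using (0F; 1F)
open import Data.Vec using (Vec; []; _∷_; lookup; tabulate; replicate)
open import Data.Vec.Properties using (lookup∘tabulate)
open import Data.Vec.Relation.Binary.Pointwise.Inductive using (Pointwise; []; _∷_; tabulate⁺)
  renaming (sym to pointwise-sym)
open import Data.Product using (∃; _×_; _,_; proj₁; proj₂)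
open import Data.Empty using (⊥; ⊥-elim)
open import Relation.Nullary using (yes; no; contradiction)
open import Relation.Unary using (Pred; Decidable)
open import Relation.Binary.PropositionalEquality
open import Level using (Level)
open import Function using (_∘_)
open import Function.Definitions using (Injective)

private
  variable
    ℓ : Level
    m n : ℕ

argmax : (v : Fin (suc n) → ℕ) → ∃ λ i → ∀ j → v j ≤ v i
argmax {zero} v = zero , λ { zero → ≤-refl }
argmax {suc n} v with argmax (v ∘ suc)
... | i , max with v zero ≤? v (suc i)
...   | yes 0≤i = suc i , λ { zero → 0≤i ; (suc j) → max j }
...   | no 0≰i = zero , λ { zero → ≤-refl ; (suc j) → ≤-trans (max j) (<⇒≤ (≰⇒> 0≰i)) }

strictMax-of-dominantClass : {P : Pred (Fin n) ℓ} → Decidable P → (v : Fin n → ℕ) → ∃ P →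
                             (∀ {i j} → i ≢ j → P i → P j → v i ≢ v j) →
                             (∀ {i j} → P i → ¬ P j → v j < v i) →
                             ∃ λ i → ∀ j → j ≢ i → v j < v i
strictMax-of-dominantClass {suc n} {P = P} P? v (p , Pp) injective dominant = i , strict
  where
  i : Fin (suc n)
  i = proj₁ (argmax v)
  max : ∀ j → v j ≤ v i
  max = proj₂ (argmax v)
  Pi : P i
  Pi with P? i
  ... | yes Pi = Pi
  ... | no ¬Pi = contradiction (max p) (<⇒≱ (dominant Pp ¬Pi))
  strict : ∀ j → j ≢ i → v j < v i
  strict j j≢i with P? j
  ... | yes Pj = ≤∧≢⇒< (max j) (injective j≢i Pj Pi)
  ... | no ¬Pj = dominant Pi ¬Pj

injective-avoiding-two : {f : Fin m → Fin n} → Injective _≡_ _≡_ f → {a b : Fin n} → a ≢ b →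
                         (∀ c → f c ≢ a) → (∀ c → f c ≢ b) → 2 + m ≤ n
injective-avoiding-two {n = 1} _ {zero} {zero} a≢b = ⊥-elim (a≢b refl)
injective-avoiding-two {m} {suc (suc n)} {f} f-inj {a} {b} a≢b f≢a f≢b = s≤s (s≤s (injective⇒≤ g-inj))
  where
  h : Fin m → Fin (suc n)
  h c = punchOut (f≢a c ∘ sym)
  b′ : Fin (suc n)
  b′ = punchOut a≢b
  b′≢h : ∀ c → b′ ≢ h c
  b′≢h c = f≢b c ∘ sym ∘ punchOut-injective a≢b (f≢a c ∘ sym)
  g : Fin m → Fin n
  g c = punchOut (b′≢h c)
  g-inj : Injective _≡_ _≡_ g
  g-inj = f-inj ∘ punchOut-injective (f≢a _ ∘ sym) (f≢a _ ∘ sym) ∘ punchOut-injective (b′≢h _) (b′≢h _)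

1F-only-at-max : {v : Fin m → Fin 2} (um : UniqueMax v) {i : Fin m} → v i ≡ 1F → i ≡ proj₁ um
1F-only-at-max {v = v} (o , above) {i} vi≡1 with i ≟ᶠ o
... | yes i≡o = i≡o
... | no i≢o = contradiction (subst (λ a → toℕ a < toℕ (v o)) vi≡1 (above i i≢o)) (<⇒≱ (toℕ<n (v o)))

max-is-1F : 2 ≤ m → {v : Fin m → Fin 2} (um : UniqueMax v) → v (proj₁ um) ≡ 1F
max-is-1F (s≤s (s≤s _)) (o , above) = above-is-1F (above (punchIn o zero) (punchInᵢ≢i o zero))
  where
  above-is-1F : {a b : Fin 2} → toℕ a < toℕ b → b ≡ 1F
  above-is-1F {b = 1F} _ = refl

ones : Vec (Fin 2) n → ℕ
ones [] = 0
ones (0F ∷ xs) = ones xs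
ones (1F ∷ xs) = suc (ones xs)

Disjoint : Vec (Fin 2) n → Vec (Fin 2) n → Set
Disjoint = Pointwise (λ a b → ¬ (a ≡ 1F × b ≡ 1F))

disjoint-sym : {xs ys : Vec (Fin 2) n} → Disjoint xs ys → Disjoint ys xs
disjoint-sym = pointwise-sym (λ apart (p , q) → apart (q , p))

ones-disjoint : {xs ys : Vec (Fin 2) n} → Disjoint xs ys → ones xs + ones ys ≤ n
ones-disjoint [] = z≤n
ones-disjoint {xs = 0F ∷ _} {0F ∷ _} (_ ∷ d) = m≤n⇒m≤1+n (ones-disjoint d)
ones-disjoint {xs = 0F ∷ xs} {1F ∷ ys} (_ ∷ d) =
  ≤-trans (≤-reflexive (+-suc (ones xs) (ones ys))) (s≤s (ones-disjoint d))
ones-disjoint {xs = 1F ∷ _} {0F ∷ _} (_ ∷ d) = s≤s (ones-disjoint d)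
ones-disjoint {xs = 1F ∷ _} {1F ∷ _} (apart ∷ _) = ⊥-elim (apart (refl , refl))

one-position : (xs : Vec (Fin 2) n) → 1 ≤ ones xs → ∃ λ i → lookup xs i ≡ 1F
one-position (0F ∷ xs) 1≤xs = let i , p = one-position xs 1≤xs in suc i , p
one-position (1F ∷ xs) _ = 0F , refl

ones-positive : (xs : Vec (Fin 2) n) (i : Fin n) → lookup xs i ≡ 1F → 1 ≤ ones xs
ones-positive (0F ∷ xs) (suc i) p = ones-positive xs i p
ones-positive (1F ∷ xs) _ _ = s≤s z≤n

two-positions : (xs : Vec (Fin 2) n) {i j : Fin n} → i ≢ j →
                lookup xs i ≡ 1F → lookup xs j ≡ 1F → 2 ≤ ones xs
two-positions _ {0F} {0F} i≢j _ _ = ⊥-elim (i≢j refl)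
two-positions (1F ∷ xs) {0F} {suc j} _ _ q = s≤s (ones-positive xs j q)
two-positions (1F ∷ xs) {suc i} {0F} _ p _ = s≤s (ones-positive xs i p)
two-positions (0F ∷ xs) {suc i} {suc j} i≢j p q = two-positions xs (i≢j ∘ cong suc) p q
two-positions (1F ∷ xs) {suc i} {suc j} i≢j p q = m≤n⇒m≤1+n (two-positions xs (i≢j ∘ cong suc) p q)

-- On a set with at least two elements, colour is 2 ⊔ (the number of positions after its second largest
-- element). Disjoint sets have distinct second largest elements, and the cut-off at 2 only identifies
-- the values 1 and 2, whose sets meet in the last two positions.
colour : Vec (Fin 2) n → ℕ
colour [] = 2
colour (0F ∷ xs) = colour xs
colour {suc n} (1F ∷ xs) with ones xs ≟ 1
... | yes _ = 2 ⊔ n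
... | no _ = colour xs

2≤colour : (xs : Vec (Fin 2) n) → 2 ≤ colour xs
2≤colour [] = ≤-refl
2≤colour (0F ∷ xs) = 2≤colour xs
2≤colour {suc n} (1F ∷ xs) with ones xs ≟ 1
... | yes _ = m≤m⊔n 2 n
... | no _ = 2≤colour xs

colour≤ : (xs : Vec (Fin 2) n) → colour xs ≤ 2 ⊔ pred n
colour≤ [] = ≤-refl
colour≤ {suc n} (0F ∷ xs) = ≤-trans (colour≤ xs) (⊔-monoʳ-≤ 2 (pred[n]≤n {n}))
colour≤ {suc n} (1F ∷ xs) with ones xs ≟ 1
... | yes _ = ≤-refl
... | no _ = ≤-trans (colour≤ xs) (⊔-monoʳ-≤ 2 (pred[n]≤n {n}))

colour<length : 3 ≤ n → (xs : Vec (Fin 2) n) → colour xs < n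
colour<length {suc n} (s≤s 2≤n) xs = s≤s (≤-trans (colour≤ xs) (≤-reflexive (m≤n⇒m⊔n≡n 2≤n)))

private
  2≤-unless-1 : 2 ≤ suc m → m ≢ 1 → 2 ≤ m
  2≤-unless-1 (s≤s 1≤m) m≢1 = ≤∧≢⇒< 1≤m (m≢1 ∘ sym)

2⊔length≢colour : {xs ys : Vec (Fin 2) n} → Disjoint xs ys → ones xs ≡ 1 → 2 ≤ ones ys →
                  2 ⊔ n ≢ colour ys
2⊔length≢colour {n} {xs} {ys} d one 2≤ys eq =
  <-irrefl (trans (sym eq) (m≤n⇒m⊔n≡n (≤-trans (n≤1+n 2) 3≤n))) (colour<length 3≤n ys)
  where
  3≤n : 3 ≤ n
  3≤n = ≤-trans (+-monoʳ-≤ 1 2≤ys) (subst (λ o → o + ones ys ≤ n) one (ones-disjoint d))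

colour-disjoint : {xs ys : Vec (Fin 2) n} → Disjoint xs ys → 2 ≤ ones xs → 2 ≤ ones ys →
                  colour xs ≢ colour ys
colour-disjoint {xs = 0F ∷ _} {0F ∷ _} (_ ∷ d) 2≤xs 2≤ys = colour-disjoint d 2≤xs 2≤ys
colour-disjoint {xs = 1F ∷ _} {1F ∷ _} (apart ∷ _) = ⊥-elim (apart (refl , refl))
colour-disjoint {xs = 1F ∷ xs} {0F ∷ _} (_ ∷ d) 2≤xs 2≤ys with ones xs ≟ 1
... | yes one = 2⊔length≢colour d one 2≤ys
... | no ¬one = colour-disjoint d (2≤-unless-1 2≤xs ¬one) 2≤ys
colour-disjoint {xs = 0F ∷ _} {1F ∷ ys} (_ ∷ d) 2≤xs 2≤ys with ones ys ≟ 1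
... | yes one = 2⊔length≢colour (disjoint-sym d) one 2≤xs ∘ sym
... | no ¬one = colour-disjoint d 2≤xs (2≤-unless-1 2≤ys ¬one)

colour-nearlyFull : (xs : Vec (Fin 2) n) → n ≤ suc (ones xs) → 2 ≤ ones xs → colour xs ≡ 2
colour-nearlyFull (0F ∷ xs) (s≤s n≤xs) 2≤xs = colour-nearlyFull xs (m≤n⇒m≤1+n n≤xs) 2≤xs
colour-nearlyFull {suc n} (1F ∷ xs) (s≤s n≤1+xs) 2≤1+xs with ones xs ≟ 1
... | yes one = m≥n⇒m⊔n≡m (subst (λ o → n ≤ suc o) one n≤1+xs)
... | no ¬one = colour-nearlyFull xs n≤1+xs (2≤-unless-1 2≤1+xs ¬one)

value : Vec (Fin 2) n → ℕ
value xs with ones xs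
... | 0 = 1
... | 1 = 0
... | suc (suc _) = colour xs

value-empty : (xs : Vec (Fin 2) n) → ones xs ≡ 0 → value xs ≡ 1
value-empty xs e rewrite e = refl

value-singleton : (xs : Vec (Fin 2) n) → ones xs ≡ 1 → value xs ≡ 0
value-singleton xs e rewrite e = refl

value-big : (xs : Vec (Fin 2) n) → 2 ≤ ones xs → value xs ≡ colour xs
value-big xs 2≤xs with ones xs
value-big xs () | 0
value-big xs (s≤s ()) | 1
value-big xs _ | suc (suc _) = refl

value≤1 : (xs : Vec (Fin 2) n) → ones xs ≤ 1 → value xs ≤ 1
value≤1 xs ≤1 with ones xs
... | 0 = ≤-refl
... | 1 = z≤n
value≤1 xs (s≤s ()) | suc (suc _)

value-disjoint : {xs ys : Vec (Fin 2) n} → Disjoint xs ys → 2 ≤ ones xs → 2 ≤ ones ys →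
                 value xs ≢ value ys
value-disjoint {xs = xs} {ys} d 2≤xs 2≤ys =
  subst₂ _≢_ (sym (value-big xs 2≤xs)) (sym (value-big ys 2≤ys)) (colour-disjoint d 2≤xs 2≤ys)

value-big-dominant : (xs ys : Vec (Fin 2) n) → 2 ≤ ones xs → ones ys ≤ 1 → value ys < value xs
value-big-dominant xs ys 2≤xs ys≤1 = begin-strict
  value ys   ≤⟨ value≤1 ys ys≤1 ⟩
  1          <⟨ 2≤colour xs ⟩
  colour xs  ≡⟨ value-big xs 2≤xs ⟨
  value xs   ∎
  where open ≤-Reasoning

value<length : 3 ≤ n → (xs : Vec (Fin 2) n) → value xs < n
value<length 3≤n xs with ones xs
... | 0 = ≤-trans (s≤s (s≤s z≤n)) 3≤n
... | 1 = ≤-trans (s≤s z≤n) 3≤n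
... | suc (suc _) = colour<length 3≤n xs

isolate : Fin n → Fin n → Fin 2
isolate zero zero = 0F
isolate zero (suc _) = 1F
isolate (suc _) zero = 1F
isolate (suc i) (suc l) = isolate i l

isolate-self : (i : Fin n) → isolate i i ≡ 0F
isolate-self zero = refl
isolate-self (suc i) = isolate-self i

isolate-other : {i l : Fin n} → i ≢ l → isolate i l ≡ 1F
isolate-other {i = zero} {zero} i≢l = ⊥-elim (i≢l refl)
isolate-other {i = zero} {suc l} _ = refl
isolate-other {i = suc i} {zero} _ = refl
isolate-other {i = suc i} {suc l} i≢l = isolate-other (i≢l ∘ cong suc)

IsolationInvariant : ∀ {k p} → ((Fin p → Fin 2) → Fin k) → Set
IsolationInvariant f = ∀ i j x → minorFun (isolate i) f x ≡ minorFun (isolate j) f x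

isolated : Fin 2 → Fin 2 → Fin n → Vec (Fin 2) n
isolated a b zero = a ∷ replicate _ b
isolated a b (suc i) = b ∷ isolated a b i

tabulate-const : (a : Fin 2) → tabulate {n = n} (λ _ → a) ≡ replicate n a
tabulate-const {zero} a = refl
tabulate-const {suc n} a = cong (a ∷_) (tabulate-const a)

tabulate-isolate : (x : Fin 2 → Fin 2) (i : Fin n) → tabulate (x ∘ isolate i) ≡ isolated (x 0F) (x 1F) i
tabulate-isolate x zero = cong (x 0F ∷_) (tabulate-const (x 1F))
tabulate-isolate x (suc i) = cong (x 1F ∷_) (tabulate-isolate x i)

isolated-constant : (a : Fin 2) (i : Fin n) → isolated a a i ≡ replicate n a
isolated-constant a zero = refl
isolated-constant a (suc i) = cong (a ∷_) (isolated-constant a i)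

ones-replicate-0F : ∀ n → ones (replicate n 0F) ≡ 0
ones-replicate-0F zero = refl
ones-replicate-0F (suc n) = ones-replicate-0F n

ones-replicate-1F : ∀ n → ones (replicate n 1F) ≡ n
ones-replicate-1F zero = refl
ones-replicate-1F (suc n) = cong suc (ones-replicate-1F n)

ones-singleton : (i : Fin n) → ones (isolated 1F 0F i) ≡ 1
ones-singleton {suc n} zero = cong suc (ones-replicate-0F n)
ones-singleton (suc i) = ones-singleton i

ones-cosingleton : (i : Fin n) → suc (ones (isolated 0F 1F i)) ≡ n
ones-cosingleton {suc n} zero = cong suc (ones-replicate-1F n)
ones-cosingleton (suc i) = cong suc (ones-cosingleton i)

value-cosingleton : 3 ≤ n → (i : Fin n) → value (isolated 0F 1F i) ≡ 2
value-cosingleton {n} 3≤n i = begin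
  value (isolated 0F 1F i)   ≡⟨ value-big (isolated 0F 1F i) 2≤ones ⟩
  colour (isolated 0F 1F i)  ≡⟨ colour-nearlyFull (isolated 0F 1F i) n≤1+ones 2≤ones ⟩
  2                          ∎
  where
  open ≡-Reasoning
  n≤1+ones : n ≤ suc (ones (isolated 0F 1F i))
  n≤1+ones = ≤-reflexive (sym (ones-cosingleton i))
  2≤ones : 2 ≤ ones (isolated 0F 1F i)
  2≤ones = s≤s⁻¹ (subst (3 ≤_) (sym (ones-cosingleton i)) 3≤n)

value-isolated : 3 ≤ n → (a b : Fin 2) (i j : Fin n) → value (isolated a b i) ≡ value (isolated a b j)
value-isolated _ 0F 0F i j = cong value (trans (isolated-constant 0F i) (sym (isolated-constant 0F j)))
value-isolated _ 1F 1F i j = cong value (trans (isolated-constant 1F i) (sym (isolated-constant 1F j)))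
value-isolated _ 1F 0F i j = trans (value-singleton (isolated 1F 0F i) (ones-singleton i))
                                   (sym (value-singleton (isolated 1F 0F j) (ones-singleton j)))
value-isolated 3≤n 0F 1F i j = trans (value-cosingleton 3≤n i) (sym (value-cosingleton 3≤n j))

module LOPolymorphism {k : ℕ} (3≤k : 3 ≤ k) where

  polymorphism : (Fin k → Fin 2) → Fin k
  polymorphism x = fromℕ< (value<length 3≤k (tabulate x))

  toℕ-polymorphism : ∀ x → toℕ (polymorphism x) ≡ value (tabulate x)
  toℕ-polymorphism x = toℕ-fromℕ< (value<length 3≤k (tabulate x))

  module _ (M : Fin (k + 1) → Fin k → Fin 2) (columns : ∀ c → LO 2 (k + 1) (λ i → M i c)) where

    row : Fin (k + 1) → Vec (Fin 2) k
    row i = tabulate (M i)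

    owner : Fin k → Fin (k + 1)
    owner c = proj₁ (columns c)

    owner-unique : ∀ {i c} → M i c ≡ 1F → i ≡ owner c
    owner-unique = 1F-only-at-max (columns _)

    row-owner : ∀ {i c} → lookup (row i) c ≡ 1F → i ≡ owner c
    row-owner {i} {c} = owner-unique ∘ trans (sym (lookup∘tabulate (M i) c))

    owner-in-row : ∀ c → lookup (row (owner c)) c ≡ 1F
    owner-in-row c = trans (lookup∘tabulate (M (owner c)) c)
                           (max-is-1F (≤-trans (n≤1+n 2) (≤-trans 3≤k (m≤m+n k 1))) (columns c))

    rows-disjoint : ∀ {i j} → i ≢ j → Disjoint (row i) (row j)
    rows-disjoint i≢j = tabulate⁺ λ c (p , q) → i≢j (trans (owner-unique p) (sym (owner-unique q)))

    some-row-empty : ∃ λ z → ones (row z) ≡ 0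
    some-row-empty with any? (λ i → ones (row i) ≟ 0)
    ... | yes empty = empty
    ... | no ¬empty = ⊥-elim (1+n≰n (subst (_≤ k) (+-comm k 1) (injective⇒≤ pick-injective)))
      where
      pick : ∀ i → ∃ λ c → lookup (row i) c ≡ 1F
      pick i = one-position (row i) (n≢0⇒n>0 (¬empty ∘ (i ,_)))
      pick-injective : Injective _≡_ _≡_ (proj₁ ∘ pick)
      pick-injective {i} {j} eq =
        trans (row-owner (proj₂ (pick i))) (trans (cong owner eq) (sym (row-owner (proj₂ (pick j)))))

    at-most-one-empty : (∀ i → ones (row i) ≤ 1) → ∀ {i j} → i ≢ j →
                        ones (row i) ≡ 0 → ones (row j) ≡ 0 → ⊥
    at-most-one-empty ≤1 i≢j i-empty j-empty =
      1+n≰n (subst (2 + k ≤_) (+-comm k 1)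
                   (injective-avoiding-two owner-injective i≢j (avoids i-empty) (avoids j-empty)))
      where
      owner-injective : Injective _≡_ _≡_ owner
      owner-injective {c} {c′} eq with c ≟ᶠ c′
      ... | yes c≡c′ = c≡c′
      ... | no c≢c′ = contradiction (≤1 (owner c)) (<⇒≱ (two-positions (row (owner c)) c≢c′
                        (owner-in-row c) (subst (λ i → lookup (row i) c′ ≡ 1F) (sym eq)
                                                (owner-in-row c′))))
      avoids : ∀ {z} → ones (row z) ≡ 0 → ∀ c → owner c ≢ z
      avoids empty c refl with () ← subst (1 ≤_) empty (ones-positive (row (owner c)) c (owner-in-row c))

    value-strictMax : ∃ λ i → ∀ j → j ≢ i → value (row j) < value (row i)
    value-strictMax with any? (λ i → 2 ≤? ones (row i))
    ... | yes big = strictMax-of-dominantClass (λ i → 2 ≤? ones (row i)) (value ∘ row) big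
          (value-disjoint ∘ rows-disjoint)
          (λ {i} {j} 2≤i 2≰j → value-big-dominant (row i) (row j) 2≤i (≮⇒≥ 2≰j))
    ... | no ¬big = strictMax-of-dominantClass (λ i → ones (row i) ≟ 0) (value ∘ row) some-row-empty
          (λ i≢j i-empty j-empty _ → at-most-one-empty ≤1 i≢j i-empty j-empty)
          (λ {i} {j} i-empty j-nonempty → subst₂ _<_
               (sym (value-singleton (row j) (≤-antisym (≤1 j) (n≢0⇒n>0 j-nonempty))))
               (sym (value-empty (row i) i-empty)) (s≤s z≤n))
      where
      ≤1 : ∀ i → ones (row i) ≤ 1
      ≤1 i = ≮⇒≥ (¬big ∘ (i ,_))

  isPol : IsPol (k + 1) k k polymorphism
  isPol M columns =
    let i , strict = value-strictMax M columns in
    i , λ j j≢i → subst₂ _<_ (sym (toℕ-polymorphism (M j))) (sym (toℕ-polymorphism (M i))) (strict j j≢i)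

  isolationInvariant : IsolationInvariant polymorphism
  isolationInvariant i j x = toℕ-injective (begin
    toℕ (polymorphism (x ∘ isolate i))  ≡⟨ toℕ-polymorphism (x ∘ isolate i) ⟩
    value (tabulate (x ∘ isolate i))    ≡⟨ cong value (tabulate-isolate x i) ⟩
    value (isolated (x 0F) (x 1F) i)    ≡⟨ value-isolated 3≤k (x 0F) (x 1F) i j ⟩
    value (isolated (x 0F) (x 1F) j)    ≡⟨ cong value (tabulate-isolate x j) ⟨
    value (tabulate (x ∘ isolate j))    ≡⟨ toℕ-polymorphism (x ∘ isolate j) ⟨
    toℕ (polymorphism (x ∘ isolate j))  ∎)
    where open ≡-Reasoning

minor-isPol : ∀ {r k p q} (π : Fin p → Fin q) (f : Pol r k p) → IsPol r k q (minorFun π (fun f))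
minor-isPol π (f , f-isPol) M columns = f-isPol (λ i j → M i (π j)) (columns ∘ π)

MinionHom-isolationInvariant : ∀ {k r₁ r₂ p} (hom : MinionHom k r₁ r₂) (f : Pol r₁ k p) →
                               IsolationInvariant (fun f) → IsolationInvariant (fun (MinionHom.ξ hom p f))
MinionHom-isolationInvariant {k} {r₁} hom f invariant i j x =
  trans (sym (commutes (isolate i) f fᵢ (λ _ → refl) x)) (commutes (isolate j) f fᵢ (invariant i j) x)
  where
  open MinionHom hom
  fᵢ : Pol r₁ k 2
  fᵢ = minorFun (isolate i) (fun f) , minor-isPol (isolate i) f

¬isolationInvariant : ∀ {k p} → 2 ≤ p → (g : Pol p k p) → ¬ IsolationInvariant (fun g)
¬isolationInvariant {p = p} (s≤s (s≤s _)) (g , g-isPol) invariant =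
  <-irrefl (cong toℕ (invariant j i opposite)) (above j (punchInᵢ≢i i zero))
  where
  identity : Fin p → Fin p → Fin 2
  identity r c = opposite (isolate r c)
  identity-columns : ∀ c → LO 2 p (λ r → identity r c)
  identity-columns c = c , λ r r≢c → subst₂ (λ a b → toℕ (opposite a) < toℕ (opposite b))
                                            (sym (isolate-other r≢c)) (sym (isolate-self c)) (s≤s z≤n)
  i : Fin p
  i = proj₁ (g-isPol identity identity-columns)
  above : ∀ j → j ≢ i → toℕ (g (identity j)) < toℕ (g (identity i))
  above = proj₂ (g-isPol identity identity-columns)
  j : Fin p
  j = punchIn i zero

theorem5p23 : ∀ (k : ℕ) → 3 ≤ k → ¬ MinionHom k (k + 1) k
theorem5p23 k 3≤k hom =
  ¬isolationInvariant (≤-trans (n≤1+n 2) 3≤k) (ξ k f)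
                      (MinionHom-isolationInvariant hom f isolationInvariant)
  where
  open LOPolymorphism 3≤k
  open MinionHom hom
  f : Pol (k + 1) k k
  f = polymorphism , isPol
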